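{- Let $n\ge1$. For every $J\subseteq\{0,1,\dots,n-1\}$, $$\varphi(X_J)=2^{\#J}\sum_{F\in\mathcal F_n,\ F\subseteq J\cup(J+1)}P_F.$$
   Context: Type B: $\mathcal B_n$ is the group of signed permutations (bijections $w$ of $\{\pm1,\dots,\pm n\}$ with $w(-i)=-w(i)$), written $w_1\cdots w_n$, negative entries $-k$ written $\bar k$, ordered $\cdots<\bar2<\bar1<1<2<\cdots$. $\mathrm{Des}(w)=\{i\in\{0,\dots,n-1\}:w_i>w_{i+1}\}$ with $w_0=0$. For $J\subseteq\{0,\dots,n-1\}$, $Y_J=\sum_{\mathrm{Des}(w)=J}w$ and $X_J=\sum_{I\subseteq J}Y_I=\sum_{\mathrm{Des}(w)\subseteq J}w$. $\varphi:\mathbb Q\mathcal B_n\to\mathbb Q\mathcal S_n$ is the linear map forgetting signs, $w\mapsto|w_1|\cdots|w_n|$. $J+1=\{j+1:j\in J\}$. Type A: for $u\in\mathcal S_n$, $\mathrm{Peak}(u)=\{i\in\{1,\dots,n-1\}:u_{i-1}<u_i>u_{i+1}\}$ with $u_0=0$; $\mathcal F_n$ is the set of subsets of $\{1,\dots,n-1\}$ with no two consecutive integers; $P_F=\sum_{\mathrm{Peak}(u)=F}u$. -}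

module Defs where

open import Data.Bool using (Bool; true; false; _∧_; _∨_; not; T; if_then_else_)
open import Data.Nat as ℕ using (ℕ; zero; suc; _∸_; _<ᵇ_; _≡ᵇ_)
open import Data.Integer as ℤ using (ℤ; +_; ∣_∣)
open import Data.Fin using (Fin; toℕ)
open import Data.Vec as Vec using (Vec; []; _∷_; tabulate; toList; lookup)
open import Data.List as List using (List; []; _∷_)
open import Data.Fin.Subset using (Subset; _∪_)
open import Data.Product using (Σ; _×_)
open import Relation.Binary.PropositionalEquality using (_≡_)

nth : {A : Set} → A → List A → ℕ → A
nth d []       _       = d
nth d (x ∷ xs) zero    = x
nth d (x ∷ xs) (suc k) = nth d xs k

-- 1-indexed entries with the convention w_0 = 0
wAt : {n : ℕ} → Vec ℤ n → ℕ → ℤ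
wAt w zero    = + 0
wAt w (suc k) = nth (+ 0) (toList w) k

uAt : {n : ℕ} → Vec ℕ n → ℕ → ℕ
uAt u zero    = 0
uAt u (suc k) = nth 0 (toList u) k

_<ℤᵇ_ : ℤ → ℤ → Bool
x <ℤᵇ y = ℤ._≤ᵇ_ x y ∧ not (ℤ._≤ᵇ_ y x)

_⊆ᵇ_ : {n : ℕ} → Subset n → Subset n → Bool
[]      ⊆ᵇ []      = true
(a ∷ p) ⊆ᵇ (b ∷ q) = (not a ∨ b) ∧ (p ⊆ᵇ q)

allL : {A : Set} → (A → Bool) → List A → Bool
allL P []       = true
allL P (x ∷ xs) = P x ∧ allL P xs

distinct : List ℕ → Bool
distinct []       = true
distinct (x ∷ xs) = allL (λ y → not (x ≡ᵇ y)) xs ∧ distinct xs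

isPerm : {n : ℕ} → Vec ℕ n → Bool
isPerm {n} u = allL (λ x → (0 <ᵇ x) ∧ (x ℕ.≤ᵇ n)) (toList u) ∧ distinct (toList u)

-- B_n: w_1 ... w_n in ℤ such that |w_1| ... |w_n| ∈ S_n
-- (equivalently a bijection of {±1..±n} with w(-i) = -w(i))
isSignedPerm : {n : ℕ} → Vec ℤ n → Bool
isSignedPerm w = isPerm (Vec.map ∣_∣ w)

φ : {n : ℕ} → Vec ℤ n → Vec ℕ n
φ w = Vec.map ∣_∣ w

Des : {n : ℕ} → Vec ℤ n → Subset n
Des w = tabulate (λ i → wAt w (suc (toℕ i)) <ℤᵇ wAt w (toℕ i))

Peak : {n : ℕ} → Vec ℕ n → Subset n
Peak u = tabulate (λ i → peakAt (toℕ i))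
  where
  peakAt : ℕ → Bool
  peakAt zero    = false
  peakAt (suc k) = (uAt u k <ᵇ uAt u (suc k)) ∧ (uAt u (suc (suc k)) <ᵇ uAt u (suc k))

-- J + 1, intersected with {0,...,n-1} (sufficient, since we only test subsets of {1,...,n-1})
shift : {n : ℕ} → Subset n → Subset n
shift {n} J = tabulate (λ i → sh (toℕ i))
  where
  sh : ℕ → Bool
  sh zero    = false
  sh (suc k) = nth false (toList J) k

noConsec : List Bool → Bool
noConsec []           = true
noConsec (a ∷ [])     = true
noConsec (a ∷ b ∷ xs) = not (a ∧ b) ∧ noConsec (b ∷ xs)

inFn : {n : ℕ} → Subset n → Bool
inFn F = not (nth false (toList F) 0) ∧ noConsec (toList F)

-- coefficient of the basis element u in  Σ_{F ∈ 𝓕_n, F ⊆ J ∪ (J+1)} P_F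
-- (P_F = Σ_{Peak(u)=F} u, so the only contributing F is F = Peak(u))
rhsIndicator : {n : ℕ} → Subset n → Vec ℕ n → ℕ
rhsIndicator J u = if inFn (Peak u) ∧ (Peak u ⊆ᵇ (J ∪ shift J)) then 1 else 0

-- the signed permutations contributing to the coefficient of u in φ(X_J):
-- w ∈ B_n with Des(w) ⊆ J and φ(w) = u
LHSTerms : (n : ℕ) → Subset n → Vec ℕ n → Set
LHSTerms n J u = Σ (Vec ℤ n) (λ w → T (isSignedPerm w) × (T (Des w ⊆ᵇ J) × φ w ≡ u))

{-# OPTIONS --safe #-}
-- Fix u and consider the signed words w with |w| = u.  Consecutive entries of u differ, so
-- whether the slot i is an ascent (wᵢ < wᵢ₊₁, with w₀ = 0) depends only on the sign of the entry
-- of larger absolute value among positions i and i + 1: that entry must be positive if it sits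
-- at i + 1 and negative if it sits at i.  Hence every slot outside J fixes one sign.  Two slots
-- fix the same sign only at a peak k with k - 1, k ∉ J, and then in opposite ways; otherwise the
-- n - #J slots outside J fix n - #J distinct signs and leave 2^#J words.  Peaks are never
-- adjacent, so Peak(u) ∈ 𝓕ₙ always holds.

module Submission where

open import Axiom.UniquenessOfIdentityProofs using (module Decidable⇒UIP)
open import Data.Bool using (Bool; true; false; T; _∧_; _∨_; not; if_then_else_)
open import Data.Bool.Properties
  using (T-∧; T-≡; T-not-≡; T-irrelevant; ∧-zeroʳ; ∨-zeroʳ; ∨-comm; not-involutive; if-eta)
open import Data.Empty using (⊥-elim)
open import Data.Fin using (Fin; toℕ)
open import Data.Fin.Properties using (0↔⊥; 1↔⊤; +↔⊎)
open import Data.Fin.Subset using (Subset; ∣_∣; _∪_)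
open import Data.Integer using (ℤ; +_; -[1+_]; -_) renaming (∣_∣ to ∣_∣ℤ)
open import Data.List using (List; []; _∷_)
open import Data.List.Relation.Unary.All as All using (All; []; _∷_)
open import Data.List.Relation.Unary.Linked using (Linked; []; [-]; _∷_)
open import Data.Nat using (ℕ; zero; suc; _+_; _*_; _^_; _≤_; _<_; _<ᵇ_; _≤ᵇ_; _≡ᵇ_; z<s)
open import Data.Nat.Properties
  using (_≟_; <ᵇ⇒<; ≡⇒≡ᵇ; >⇒≢; *-identityˡ; *-distribˡ-+; *-distribʳ-+)
open import Data.Nat.Tactic.RingSolver using (solve-∀)
open import Data.Product using (Σ; _×_; _,_; proj₁; proj₂)
open import Data.Product.Properties using (Σ-≡,≡→≡)
open import Data.Sum using (_⊎_; inj₁; inj₂)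
open import Data.Sum.Function.Propositional using (_⊎-↔_)
open import Data.Unit using (tt)
open import Data.Vec as Vec using (Vec; []; _∷_; zipWith; tabulate; toList)
open import Data.Vec.Properties using (≡-dec)
open import Function using (_∘_)
open import Function.Bundles using (_↔_; Equivalence; mk↔ₛ′)
open import Function.Properties.Inverse using (↔-trans; ↔-sym)
open import Relation.Binary.PropositionalEquality
  using (_≡_; _≢_; refl; sym; trans; cong; cong₂; subst; module ≡-Reasoning)

open import Defs

private
  variable
    m n : ℕ

𝟙 : Bool → ℕ
𝟙 b = if b then 1 else 0

𝟙-∧ : ∀ a b → 𝟙 (a ∧ b) ≡ 𝟙 a * 𝟙 b
𝟙-∧ true  b = sym (*-identityˡ (𝟙 b))
𝟙-∧ false b = refl

count : (n : ℕ) → (Vec Bool n → Bool) → ℕ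
count zero    P = 𝟙 (P [])
count (suc n) P = count n (P ∘ (false ∷_)) + count n (P ∘ (true ∷_))

Solutions : (n : ℕ) → (Vec Bool n → Bool) → Set
Solutions n P = Σ (Vec Bool n) (T ∘ P)

T↔Fin𝟙 : ∀ b → T b ↔ Fin (𝟙 b)
T↔Fin𝟙 true  = ↔-sym 1↔⊤
T↔Fin𝟙 false = ↔-sym 0↔⊥

Solutions-∷↔⊎ : (P : Vec Bool (suc n) → Bool) →
  Solutions (suc n) P ↔ (Solutions n (P ∘ (false ∷_)) ⊎ Solutions n (P ∘ (true ∷_)))
Solutions-∷↔⊎ P = mk↔ₛ′ to from
  (λ { (inj₁ _) → refl ; (inj₂ _) → refl })
  (λ { ((false ∷ s) , _) → refl ; ((true ∷ s) , _) → refl })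
  where
  to : Solutions _ P → Solutions _ (P ∘ (false ∷_)) ⊎ Solutions _ (P ∘ (true ∷_))
  to ((false ∷ s) , p) = inj₁ (s , p)
  to ((true  ∷ s) , p) = inj₂ (s , p)
  from : Solutions _ (P ∘ (false ∷_)) ⊎ Solutions _ (P ∘ (true ∷_)) → Solutions _ P
  from (inj₁ (s , p)) = false ∷ s , p
  from (inj₂ (s , p)) = true  ∷ s , p

Solutions↔Fin-count : (n : ℕ) (P : Vec Bool n → Bool) → Solutions n P ↔ Fin (count n P)
Solutions↔Fin-count zero P =
  ↔-trans (mk↔ₛ′ (λ { ([] , p) → p }) ([] ,_) (λ _ → refl) (λ { ([] , _) → refl })) (T↔Fin𝟙 (P []))
Solutions↔Fin-count (suc n) P = ↔-trans (Solutions-∷↔⊎ P)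
  (↔-trans (Solutions↔Fin-count n _ ⊎-↔ Solutions↔Fin-count n _) (↔-sym +↔⊎))

count-cong : (n : ℕ) {P Q : Vec Bool n → Bool} → (∀ s → P s ≡ Q s) → count n P ≡ count n Q
count-cong zero    P≡Q = cong 𝟙 (P≡Q [])
count-cong (suc n) P≡Q =
  cong₂ _+_ (count-cong n (P≡Q ∘ (false ∷_))) (count-cong n (P≡Q ∘ (true ∷_)))

count-∧ˡ : (n : ℕ) (b : Bool) (P : Vec Bool n → Bool) → count n (λ s → b ∧ P s) ≡ 𝟙 b * count n P
count-∧ˡ zero    b P = 𝟙-∧ b (P [])
count-∧ˡ (suc n) b P =
  trans (cong₂ _+_ (count-∧ˡ n b _) (count-∧ˡ n b _)) (sym (*-distribˡ-+ (𝟙 b) _ _))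

count-∷-∧ : (P : Vec Bool (suc n) → Bool) (g : Bool → Bool) (Q : Vec Bool n → Bool) →
  (∀ b s → P (b ∷ s) ≡ g b ∧ Q s) → count (suc n) P ≡ (𝟙 (g false) + 𝟙 (g true)) * count n Q
count-∷-∧ {n} P g Q split = begin
  count n (P ∘ (false ∷_)) + count n (P ∘ (true ∷_))
    ≡⟨ cong₂ _+_ (count-cong n (split false)) (count-cong n (split true)) ⟩
  count n (λ s → g false ∧ Q s) + count n (λ s → g true ∧ Q s)
    ≡⟨ cong₂ _+_ (count-∧ˡ n (g false) Q) (count-∧ˡ n (g true) Q) ⟩
  𝟙 (g false) * count n Q + 𝟙 (g true) * count n Q
    ≡⟨ sym (*-distribʳ-+ (count n Q) (𝟙 (g false)) (𝟙 (g true))) ⟩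
  (𝟙 (g false) + 𝟙 (g true)) * count n Q
    ∎
  where open ≡-Reasoning

∧-elim : ∀ a {b} → T (a ∧ b) → T a × T b
∧-elim a = Equivalence.to (T-∧ {a})

not-not-∨ : ∀ a b → (not (not a) ∨ b) ≡ (b ∨ a)
not-not-∨ a b = trans (cong (_∨ b) (not-involutive a)) (∨-comm a b)

<ᵇ-suc : ∀ m n → (m <ᵇ suc n) ≡ (m ≤ᵇ n)
<ᵇ-suc zero    n = refl
<ᵇ-suc (suc m) n = refl

≤ᵇ∧≰ᵇ : ∀ m n → ((m ≤ᵇ n) ∧ not (n ≤ᵇ m)) ≡ (m <ᵇ n)
≤ᵇ∧≰ᵇ zero    zero    = refl
≤ᵇ∧≰ᵇ zero    (suc n) = refl
≤ᵇ∧≰ᵇ (suc m) zero    = refl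
≤ᵇ∧≰ᵇ (suc m) (suc n) rewrite <ᵇ-suc m n | <ᵇ-suc n m = ≤ᵇ∧≰ᵇ m n

<ᵇ-flip : ∀ {m n} → m ≢ n → (m <ᵇ n) ≡ not (n <ᵇ m)
<ᵇ-flip {zero}  {zero}  0≢0 = ⊥-elim (0≢0 refl)
<ᵇ-flip {zero}  {suc n} _   = refl
<ᵇ-flip {suc m} {zero}  _   = refl
<ᵇ-flip {suc m} {suc n} m≢n = <ᵇ-flip (m≢n ∘ cong suc)

<ᵇ-asym : ∀ m n → T (m <ᵇ n) → (n <ᵇ m) ≡ false
<ᵇ-asym zero    (suc n) _   = refl
<ᵇ-asym (suc m) (suc n) m<n = <ᵇ-asym m n m<n

allL⇒All : (P : ℕ → Bool) (xs : List ℕ) → T (allL P xs) → All (T ∘ P) xs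
allL⇒All P []       _ = []
allL⇒All P (x ∷ xs) t = let px , pxs = ∧-elim (P x) t in px ∷ allL⇒All P xs pxs

distinct⇒Linked≢ : (xs : List ℕ) → T (distinct xs) → Linked _≢_ xs
distinct⇒Linked≢ []           _ = []
distinct⇒Linked≢ (x ∷ [])     _ = [-]
distinct⇒Linked≢ (x ∷ y ∷ xs) t =
  let x≉ys , rest = ∧-elim (allL (λ z → not (x ≡ᵇ z)) (y ∷ xs)) t
      x≉y  , _    = ∧-elim (not (x ≡ᵇ y)) x≉ys
  in (λ x≡y → subst T (Equivalence.to T-not-≡ x≉y) (≡⇒≡ᵇ x y x≡y)) ∷ distinct⇒Linked≢ (y ∷ xs) rest

isPerm⇒positive : (u : Vec ℕ n) → T (isPerm u) → All (0 <_) (toList u)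
isPerm⇒positive u perm = All.map (λ {x} t → <ᵇ⇒< 0 x (proj₁ (∧-elim (0 <ᵇ x) t)))
  (allL⇒All _ (toList u) (proj₁ (∧-elim (allL _ (toList u)) perm)))

isPerm⇒Linked≢ : (u : Vec ℕ n) → T (isPerm u) → Linked _≢_ (toList u)
isPerm⇒Linked≢ u perm = distinct⇒Linked≢ (toList u) (proj₂ (∧-elim (allL _ (toList u)) perm))

signed : Bool → ℕ → ℤ
signed true  k = + k
signed false k = - (+ k)

sign : ℤ → Bool
sign (+ _)    = true
sign -[1+ _ ] = false

∣signed∣ : ∀ σ k → ∣ signed σ k ∣ℤ ≡ k
∣signed∣ true  k       = refl
∣signed∣ false zero    = refl
∣signed∣ false (suc k) = refl

sign-signed : ∀ σ {k} → 0 < k → sign (signed σ k) ≡ σ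
sign-signed true  _   = refl
sign-signed false z<s = refl

signed-sign : ∀ z → signed (sign z) ∣ z ∣ℤ ≡ z
signed-sign (+ k)    = refl
signed-sign -[1+ k ] = refl

φ-signed : (s : Vec Bool n) (u : Vec ℕ n) → φ (zipWith signed s u) ≡ u
φ-signed []      []      = refl
φ-signed (σ ∷ s) (k ∷ u) = cong₂ _∷_ (∣signed∣ σ k) (φ-signed s u)

signs-signed : (s : Vec Bool n) (u : Vec ℕ n) → All (0 <_) (toList u) →
  Vec.map sign (zipWith signed s u) ≡ s
signs-signed []      []      []          = refl
signs-signed (σ ∷ s) (k ∷ u) (k>0 ∷ pos) = cong₂ _∷_ (sign-signed σ k>0) (signs-signed s u pos)

signed-signs : (w : Vec ℤ n) → zipWith signed (Vec.map sign w) (φ w) ≡ w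
signed-signs []      = refl
signed-signs (z ∷ w) = cong₂ _∷_ (signed-sign z) (signed-signs w)

signed-< : ∀ σ τ {p q} → p ≢ q → (signed σ p <ℤᵇ signed τ q) ≡ (if p <ᵇ q then τ else not σ)
signed-< true  true  {p} {q} _ rewrite ≤ᵇ∧≰ᵇ p q with p <ᵇ q
... | true  = refl
... | false = refl
signed-< true  false {p} {zero}  _ = ∧-zeroʳ (p ≤ᵇ 0)
signed-< true  false {p} {suc q} _ = sym (if-eta (p <ᵇ suc q))
signed-< false true  {zero}  {zero}  0≢0 = ⊥-elim (0≢0 refl)
signed-< false true  {zero}  {suc q} _   = refl
signed-< false true  {suc p} {q}     _   = sym (if-eta (suc p <ᵇ q))
signed-< false false {zero}  {zero}  0≢0 = ⊥-elim (0≢0 refl)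
signed-< false false {zero}  {suc q} _   = refl
signed-< false false {suc p} {zero}  _   = refl
signed-< false false {suc p} {suc q} p≢q
  rewrite ≤ᵇ∧≰ᵇ q p | <ᵇ-flip (p≢q ∘ cong suc ∘ sym) with p <ᵇ q
... | true  = refl
... | false = refl

lifts↔signs : (Q : Vec ℤ n → Bool) (u : Vec ℕ n) → All (0 <_) (toList u) →
  Σ (Vec ℤ n) (λ w → T (Q w) × φ w ≡ u) ↔ Solutions n (λ s → Q (zipWith signed s u))
lifts↔signs {n} Q u pos = mk↔ₛ′ to from to∘from from∘to
  where
  Lift : Vec ℤ n → Set
  Lift w = T (Q w) × φ w ≡ u

  Lift-irrelevant : ∀ {w} (p q : Lift w) → p ≡ q
  Lift-irrelevant (q , e) (q′ , e′) =
    cong₂ _,_ (T-irrelevant q q′) (Decidable⇒UIP.≡-irrelevant (≡-dec _≟_) e e′)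

  lift-signs : ∀ w → φ w ≡ u → zipWith signed (Vec.map sign w) u ≡ w
  lift-signs w refl = signed-signs w

  to : Σ (Vec ℤ n) Lift → Solutions n (λ s → Q (zipWith signed s u))
  to (w , q , e) = Vec.map sign w , subst (T ∘ Q) (sym (lift-signs w e)) q

  from : Solutions n (λ s → Q (zipWith signed s u)) → Σ (Vec ℤ n) Lift
  from (s , q) = zipWith signed s u , q , φ-signed s u

  to∘from : ∀ x → to (from x) ≡ x
  to∘from (s , q) = Σ-≡,≡→≡ (signs-signed s u pos , T-irrelevant _ _)

  from∘to : ∀ x → from (to x) ≡ x
  from∘to (w , q , e) = Σ-≡,≡→≡ (lift-signs w e , Lift-irrelevant _ _)

LHSTerms↔lifts : (J : Subset n) (u : Vec ℕ n) → T (isPerm u) →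
  LHSTerms n J u ↔ Σ (Vec ℤ n) (λ w → T (Des w ⊆ᵇ J) × φ w ≡ u)
LHSTerms↔lifts J u perm = mk↔ₛ′
  (λ { (w , _ , d , e) → w , d , e })
  (λ { (w , d , e) → w , subst (T ∘ isPerm) (sym e) perm , d , e })
  (λ _ → refl)
  (λ { (w , p , d , e) → cong (λ p′ → w , p′ , d , e) (T-irrelevant _ p) })

LHSTerms↔signs : (J : Subset n) (u : Vec ℕ n) → T (isPerm u) →
  LHSTerms n J u ↔ Solutions n (λ s → Des (zipWith signed s u) ⊆ᵇ J)
LHSTerms↔signs J u perm = ↔-trans (LHSTerms↔lifts J u perm)
  (lifts↔signs (λ w → Des w ⊆ᵇ J) u (isPerm⇒positive u perm))

descentsFrom : ℤ → Vec ℤ n → Subset n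
descentsFrom p []      = []
descentsFrom p (z ∷ w) = (z <ℤᵇ p) ∷ descentsFrom z w

tabulate-descents : (at : ℕ → ℤ) (p : ℤ) (w : Vec ℤ n) →
  (∀ k → at k ≡ nth (+ 0) (toList (p ∷ w)) k) →
  tabulate (λ i → at (suc (toℕ i)) <ℤᵇ at (toℕ i)) ≡ descentsFrom p w
tabulate-descents at p []      _   = refl
tabulate-descents at p (z ∷ w) at≡ =
  cong₂ _∷_ (cong₂ _<ℤᵇ_ (at≡ 1) (at≡ 0)) (tabulate-descents (at ∘ suc) z w (at≡ ∘ suc))

Des≡descentsFrom0 : (w : Vec ℤ n) → Des w ≡ descentsFrom (+ 0) w
Des≡descentsFrom0 w = tabulate-descents (wAt w) (+ 0) w wAt≡
  where
  wAt≡ : ∀ k → wAt w k ≡ nth (+ 0) (toList (+ 0 ∷ w)) k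
  wAt≡ zero    = refl
  wAt≡ (suc k) = refl

peaksFrom : ℕ → Vec ℕ (suc m) → Vec Bool m
peaksFrom a (x ∷ [])    = []
peaksFrom a (x ∷ y ∷ u) = ((a <ᵇ x) ∧ (y <ᵇ x)) ∷ peaksFrom x (y ∷ u)

tabulate-peaks : (at : ℕ → ℕ) (a : ℕ) (u : Vec ℕ (suc m)) →
  (∀ k → at k ≡ nth 0 (toList (a ∷ u)) k) →
  tabulate (λ i → (at (toℕ i) <ᵇ at (suc (toℕ i))) ∧ (at (suc (suc (toℕ i))) <ᵇ at (suc (toℕ i))))
  ≡ peaksFrom a u
tabulate-peaks at a (x ∷ [])    _   = refl
tabulate-peaks at a (x ∷ y ∷ u) at≡ =
  cong₂ _∷_ (cong₂ _∧_ (cong₂ _<ᵇ_ (at≡ 0) (at≡ 1)) (cong₂ _<ᵇ_ (at≡ 2) (at≡ 1)))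
            (tabulate-peaks (at ∘ suc) x (y ∷ u) (at≡ ∘ suc))

Peak≡false∷peaksFrom0 : (u : Vec ℕ (suc m)) → Peak u ≡ false ∷ peaksFrom 0 u
Peak≡false∷peaksFrom0 u = cong (false ∷_) (tabulate-peaks (uAt u) 0 u uAt≡)
  where
  uAt≡ : ∀ k → uAt u k ≡ nth 0 (toList (0 ∷ u)) k
  uAt≡ zero    = refl
  uAt≡ (suc k) = refl

peaksFrom-noConsec : ∀ b a x (u : Vec ℕ m) → (T b → T (x <ᵇ a)) →
  T (noConsec (b ∷ toList (peaksFrom a (x ∷ u))))
peaksFrom-noConsec b     a x []      _   = tt
peaksFrom-noConsec false a x (y ∷ u) _   = peaksFrom-noConsec _ x y u (proj₂ ∘ ∧-elim (a <ᵇ x))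
peaksFrom-noConsec true  a x (y ∷ u) x<a rewrite <ᵇ-asym x a (x<a tt) =
  peaksFrom-noConsec false x y u (λ ())

-- J starts at the slot after x.  `free` fails exactly when the slot before x is outside J and
-- the entry before x is smaller, which forces x to be positive.
admissible : Bool → ℕ → Vec ℕ m → Subset m → Vec Bool (suc m) → Bool
admissible free x u J (τ ∷ s) = (free ∨ τ) ∧ (descentsFrom (signed τ x) (zipWith signed s u) ⊆ᵇ J)

-- No sign is forced both ways; `free` as in `admissible`.
peaksCovered : Bool → ℕ → Vec ℕ m → Subset m → Bool
peaksCovered free x []      []      = true
peaksCovered free x (y ∷ u) (j ∷ J) =
  (free ∨ not (y <ᵇ x) ∨ j) ∧ peaksCovered (not (x <ᵇ y) ∨ j) y u J

signChoices : Bool → ℕ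
signChoices free = if free then 2 else 1

2^∣∷∣ : ∀ j (J : Subset m) → 2 ^ ∣ j ∷ J ∣ ≡ signChoices j * 2 ^ ∣ J ∣
2^∣∷∣ true  J = refl
2^∣∷∣ false J = sym (*-identityˡ _)

-- The constraints on the sign τ of x, where c says that the next entry is smaller than x and
-- j that the slot between them is in J.
signConstraint : (free c j τ : Bool) → Bool
signConstraint free c j τ = (free ∨ τ) ∧ (not (c ∧ τ) ∨ j)

noDescent-split : ∀ free c {c′} τ τ′ j r → c′ ≡ not c →
  (free ∨ τ) ∧ ((not (if c then τ else not τ′) ∨ j) ∧ r)
  ≡ signConstraint free c j τ ∧ ((not c′ ∨ j) ∨ τ′) ∧ r
noDescent-split true  true  true  τ′ j r refl = refl
noDescent-split false true  true  τ′ j r refl = refl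
noDescent-split true  true  false τ′ j r refl = refl
noDescent-split false true  false τ′ j r refl = refl
noDescent-split false false false τ′ j r refl = refl
noDescent-split true  false τ     τ′ j r refl = cong (_∧ r) (not-not-∨ τ′ j)
noDescent-split false false true  τ′ j r refl = cong (_∧ r) (not-not-∨ τ′ j)

signChoices-step : ∀ free c {c′} j → c′ ≡ not c →
  (𝟙 (signConstraint free c j false) + 𝟙 (signConstraint free c j true)) * signChoices (not c′ ∨ j)
  ≡ signChoices free * signChoices j * 𝟙 (free ∨ not c ∨ j)
signChoices-step true  true  true  refl = refl
signChoices-step true  true  false refl = refl
signChoices-step true  false true  refl = refl
signChoices-step true  false false refl = refl
signChoices-step false true  true  refl = refl
signChoices-step false true  false refl = refl
signChoices-step false false true  refl = refl
signChoices-step false false false refl = refl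

count-admissible : ∀ free x (u : Vec ℕ m) J → Linked _≢_ (x ∷ toList u) →
  count (suc m) (admissible free x u J) ≡ signChoices free * 2 ^ ∣ J ∣ * 𝟙 (peaksCovered free x u J)
count-admissible true  x [] [] _ = refl
count-admissible false x [] [] _ = refl
count-admissible {suc m} free x (y ∷ u) (j ∷ J) (x≢y ∷ linked) = begin
  count (suc (suc m)) (admissible free x (y ∷ u) (j ∷ J))
    ≡⟨ count-∷-∧ (admissible free x (y ∷ u) (j ∷ J)) (signConstraint free c j)
                  (admissible free′ y u J) split ⟩
  F * count (suc m) (admissible free′ y u J)
    ≡⟨ cong (F *_) (count-admissible free′ y u J linked) ⟩
  F * (signChoices free′ * 2 ^ ∣ J ∣ * 𝟙 covered′)
    ≡⟨ regroup F (signChoices free′) (signChoices free) (signChoices j) (𝟙 (free ∨ not c ∨ j))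
               (2 ^ ∣ J ∣) (𝟙 covered′) (signChoices-step free c j (<ᵇ-flip x≢y)) ⟩
  signChoices free * (signChoices j * 2 ^ ∣ J ∣) * (𝟙 (free ∨ not c ∨ j) * 𝟙 covered′)
    ≡⟨ sym (cong₂ (λ a b → signChoices free * a * b)
                  (2^∣∷∣ j J) (𝟙-∧ (free ∨ not c ∨ j) covered′)) ⟩
  signChoices free * 2 ^ ∣ j ∷ J ∣ * 𝟙 (peaksCovered free x (y ∷ u) (j ∷ J))
    ∎
  where
  open ≡-Reasoning
  c free′ covered′ : Bool
  c        = y <ᵇ x
  free′    = not (x <ᵇ y) ∨ j
  covered′ = peaksCovered free′ y u J

  F : ℕ
  F = 𝟙 (signConstraint free c j false) + 𝟙 (signConstraint free c j true)

  split : ∀ τ s → admissible free x (y ∷ u) (j ∷ J) (τ ∷ s)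
                ≡ signConstraint free c j τ ∧ admissible free′ y u J s
  split τ (τ′ ∷ s) = trans
    (cong (λ d → (free ∨ τ) ∧ ((not d ∨ j) ∧ _)) (signed-< τ′ τ (x≢y ∘ sym)))
    (noDescent-split free c τ τ′ j _ (<ᵇ-flip x≢y))

  regroup : ∀ f a b d q N P → f * a ≡ b * d * q → f * (a * N * P) ≡ b * (d * N) * (q * P)
  regroup f a b d q N P fa≡bdq = begin
    f * (a * N * P)       ≡⟨ assocˡ f a N P ⟩
    f * a * (N * P)       ≡⟨ cong (_* (N * P)) fa≡bdq ⟩
    b * d * q * (N * P)   ≡⟨ assocʳ b d q N P ⟩
    b * (d * N) * (q * P) ∎
    where
    assocˡ : ∀ f a N P → f * (a * N * P) ≡ f * a * (N * P)
    assocˡ = solve-∀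
    assocʳ : ∀ b d q N P → b * d * q * (N * P) ≡ b * (d * N) * (q * P)
    assocʳ = solve-∀

count-Des⊆ : ∀ j (J : Subset m) x (u : Vec ℕ m) → 0 < x → Linked _≢_ (x ∷ toList u) →
  count (suc m) (λ s → Des (zipWith signed s (x ∷ u)) ⊆ᵇ (j ∷ J))
  ≡ 2 ^ ∣ j ∷ J ∣ * 𝟙 (peaksCovered j x u J)
count-Des⊆ {m} j J x u x>0 linked = begin
  count (suc m) (λ s → Des (zipWith signed s (x ∷ u)) ⊆ᵇ (j ∷ J))
    ≡⟨ count-cong (suc m) first-descent ⟩
  count (suc m) (admissible j x u J)
    ≡⟨ count-admissible j x u J linked ⟩
  signChoices j * 2 ^ ∣ J ∣ * 𝟙 (peaksCovered j x u J)
    ≡⟨ cong (_* 𝟙 (peaksCovered j x u J)) (sym (2^∣∷∣ j J)) ⟩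
  2 ^ ∣ j ∷ J ∣ * 𝟙 (peaksCovered j x u J)
    ∎
  where
  open ≡-Reasoning
  first-descent : ∀ s → (Des (zipWith signed s (x ∷ u)) ⊆ᵇ (j ∷ J)) ≡ admissible j x u J s
  first-descent (τ ∷ s) = begin
    Des (signed τ x ∷ zipWith signed s u) ⊆ᵇ (j ∷ J)
      ≡⟨ cong (_⊆ᵇ (j ∷ J)) (Des≡descentsFrom0 (signed τ x ∷ zipWith signed s u)) ⟩
    (not (signed τ x <ℤᵇ signed true 0) ∨ j) ∧ rest
      ≡⟨ cong (λ d → (not d ∨ j) ∧ rest) (signed-< τ true (>⇒≢ x>0)) ⟩
    (not (not τ) ∨ j) ∧ rest
      ≡⟨ cong (_∧ rest) (not-not-∨ τ j) ⟩
    (j ∨ τ) ∧ rest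
      ∎
    where
    rest : Bool
    rest = descentsFrom (signed τ x) (zipWith signed s u) ⊆ᵇ J

-- Vec.tail (shift (j ∷ J)) is j ∷ J without its last entry.
peaksFrom-⊆-covered : ∀ a x (u : Vec ℕ m) j J →
  (peaksFrom a (x ∷ u) ⊆ᵇ (J ∪ Vec.tail (shift (j ∷ J))))
  ≡ peaksCovered (not (a <ᵇ x) ∨ j) x u J
peaksFrom-⊆-covered a x []      j []       = refl
peaksFrom-⊆-covered a x (y ∷ u) j (j′ ∷ J) =
  cong₂ _∧_ (covered (a <ᵇ x) (y <ᵇ x)) (peaksFrom-⊆-covered x y u j′ J)
  where
  covered : ∀ A C → (not (A ∧ C) ∨ (j′ ∨ j)) ≡ ((not A ∨ j) ∨ not C ∨ j′)
  covered false C     = refl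
  covered true  false = sym (∨-zeroʳ j)
  covered true  true  = ∨-comm j′ j

rhsIndicator≡𝟙-covered : ∀ j (J : Subset m) {x} (u : Vec ℕ m) → 0 < x →
  rhsIndicator (j ∷ J) (x ∷ u) ≡ 𝟙 (peaksCovered j x u J)
rhsIndicator≡𝟙-covered {m} j J {suc k} u _ = begin
  rhsIndicator (j ∷ J) (suc k ∷ u)
    ≡⟨ cong (λ P → 𝟙 (inFn P ∧ (P ⊆ᵇ ((j ∷ J) ∪ shift (j ∷ J)))))
            (Peak≡false∷peaksFrom0 (suc k ∷ u)) ⟩
  𝟙 (noConsec (false ∷ toList peaks) ∧ covered)
    ≡⟨ cong (λ b → 𝟙 (b ∧ covered))
            (Equivalence.to T-≡ (peaksFrom-noConsec false 0 (suc k) u (λ ()))) ⟩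
  𝟙 covered
    ≡⟨ cong 𝟙 (peaksFrom-⊆-covered 0 (suc k) u j J) ⟩
  𝟙 (peaksCovered j (suc k) u J)
    ∎
  where
  open ≡-Reasoning
  peaks : Vec Bool m
  peaks = peaksFrom 0 (suc k ∷ u)

  covered : Bool
  covered = peaks ⊆ᵇ (J ∪ Vec.tail (shift (j ∷ J)))

proposition3p3 : (n : ℕ) → 1 ≤ n → (J : Subset n) → (u : Vec ℕ n) → T (isPerm u) →
    LHSTerms n J u ↔ Fin (2 ^ ∣ J ∣ * rhsIndicator J u)
proposition3p3 zero    ()
proposition3p3 (suc m) _ (j ∷ J) (x ∷ u) perm =
  ↔-trans (LHSTerms↔signs (j ∷ J) (x ∷ u) perm)
          (subst (λ k → Solutions (suc m) descents⊆J ↔ Fin k) count≡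
                 (Solutions↔Fin-count (suc m) descents⊆J))
  where
  descents⊆J : Vec Bool (suc m) → Bool
  descents⊆J s = Des (zipWith signed s (x ∷ u)) ⊆ᵇ (j ∷ J)

  x>0 : 0 < x
  x>0 = All.head (isPerm⇒positive (x ∷ u) perm)

  count≡ : count (suc m) descents⊆J ≡ 2 ^ ∣ j ∷ J ∣ * rhsIndicator (j ∷ J) (x ∷ u)
  count≡ = trans (count-Des⊆ j J x u x>0 (isPerm⇒Linked≢ (x ∷ u) perm))
                 (cong (2 ^ ∣ j ∷ J ∣ *_) (sym (rhsIndicator≡𝟙-covered j J u x>0)))
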